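{- Let $k>0$ and $n\ge1$ be integers. If $M$ is a $k$-interference square matrix that has no proper square submatrix of size $n$, then the size of $M$ is less than $kn^3$.
   Context: Let $A,B$ be disjoint finite sets. An interference matrix $M=(A,B)$ is a matrix with rows indexed by $A$ and columns indexed by $B$ whose entry $m(a,b)$ for $(a,b)\in A\times B$ is a subset of $(A\cup B)\setminus\{a,b\}$. It is a $k$-interference matrix if every entry has at most $k$ elements. For $A'\subseteq A$, $B'\subseteq B$, the submatrix induced by $A'\times B'$ has rows $A'$, columns $B'$ and entries $m'(a',b')=m(a',b')\cap(A'\cup B')$. A matrix all of whose entries are empty is proper. A matrix is square if $|A|=|B|$, and its size is then its number of rows; a square submatrix of size $n$ is one induced by $A'\times B'$ with $|A'|=|B'|=n$. -}

module Defs where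

open import Data.Nat using (ℕ; _+_; _≤_)
open import Data.Fin using (Fin; _↑ˡ_; _↑ʳ_)
open import Data.Fin.Subset using (Subset; _∈_; _∉_; ∣_∣)
open import Data.Product using (_×_; Σ)
open import Relation.Binary.PropositionalEquality using (_≡_)

-- A square interference matrix of size m: rows A = Fin m, columns B = Fin m,
-- A and B disjoint; A ∪ B is encoded as Fin (m + m), with row a as
-- (a ↑ˡ m) and column b as (m ↑ʳ b).
row : {m : ℕ} → Fin m → Fin (m + m)
row {m} a = a ↑ˡ m

col : {m : ℕ} → Fin m → Fin (m + m)
col {m} b = m ↑ʳ b

record SqInterferenceMatrix (m : ℕ) : Set where
  field
    entry     : Fin m → Fin m → Subset (m + m)
    noRow     : ∀ a b → row a ∉ entry a b
    noCol     : ∀ a b → col b ∉ entry a b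

open SqInterferenceMatrix public

IsKInterference : {m : ℕ} → ℕ → SqInterferenceMatrix m → Set
IsKInterference k M = ∀ a b → ∣ entry M a b ∣ ≤ k

ProperSub : {m : ℕ} → SqInterferenceMatrix m → Subset m → Subset m → Set
ProperSub M A' B' =
  ∀ a b → a ∈ A' → b ∈ B' →
    (∀ a' → a' ∈ A' → row a' ∉ entry M a b) ×
    (∀ b' → b' ∈ B' → col b' ∉ entry M a b)

HasProperSquareSub : {m : ℕ} → SqInterferenceMatrix m → ℕ → Set
HasProperSquareSub {m} M n =
  Σ (Subset m) λ A' → Σ (Subset m) λ B' →
    (∣ A' ∣ ≡ n) × (∣ B' ∣ ≡ n) × ProperSub M A' B'

module Submission where

-- Proof by averaging over all pairs of n-element subsets.
--
-- For subsets A, B of the row and column indices, let violations(A, B)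
-- count the triples (a, b, x) with a ∈ A, b ∈ B and x ∈ m(a,b) ∩ (A ∪ B);
-- the submatrix A × B is proper when this number is 0.  Summing over all
-- pairs of n-subsets (A, B), a triple whose x is a row a' ≠ a is counted
-- once for every A ∋ a, a' and every B ∋ b, i.e. C(m-2,n-2) · C(m-1,n-1)
-- times, and symmetrically for columns.  As each entry has at most k
-- elements, the grand total is at most m² k C(m-1,n-1) C(m-2,n-2).  The
-- absorption identity n C(m,n) = m C(m-1,n-1) turns m ≥ k n³ into "this
-- total is below C(m,n)²", so some pair (A, B) has no violation at all,
-- and A × B is a proper square submatrix of size n.

open import Defs
open import Data.Nat using (ℕ; _*_; _^_; _<_; _≥_)
open import Relation.Nullary using (¬_)

open import Data.Nat using (zero; suc; _+_; _≤_; z≤n; s≤s; s≤s⁻¹; NonZero; >-nonZero)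
open import Data.Nat.Properties
open import Data.Nat.Tactic.RingSolver using (solve-∀)
open import Data.Bool using (Bool; true; false)
open import Data.Fin using (Fin; zero; suc; _↑ˡ_; _↑ʳ_; splitAt)
open import Data.Fin.Subset using (Subset; inside; outside; _∈_; ∣_∣)
open import Data.Vec using ([]; _∷_; lookup)
import Data.Vec as Vec
open import Data.Vec.Properties using ([]=⇒lookup; lookup⇒[]=; lookup-++ˡ; lookup-++ʳ)
import Data.Vec.Functional as Vector
import Data.Vec.Functional.Properties as Vector
open import Data.Sum using (inj₁; inj₂)
open import Data.Product using (Σ; _,_)
open import Data.Empty using (⊥-elim)
open import Function using (_∘_)
open import Relation.Nullary using (yes; no)
open import Relation.Binary.PropositionalEquality
open import Algebra.Properties.CommutativeSemigroup *-commutativeSemigroup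
  using (x∙yz≈y∙xz; xy∙z≈xz∙y)
open import Algebra.Properties.Semiring.Sum +-*-semiring
  using (sum; sum-syntax; ∑-comm; *-distribˡ-sum; *-distribʳ-sum; sum-cong-≗; sum-replicate-zero)

𝟙 : Bool → ℕ
𝟙 true  = 1
𝟙 false = 0

χ : {p : ℕ} → Subset p → Fin p → ℕ
χ S i = 𝟙 (lookup S i)

∈⇒χ≡1 : {p : ℕ} {S : Subset p} {i : Fin p} → i ∈ S → χ S i ≡ 1
∈⇒χ≡1 i∈S = cong 𝟙 ([]=⇒lookup i∈S)

𝟙-guard : (e : Bool) {u v : ℕ} → (e ≡ true → u ≡ v) → 𝟙 e * u ≡ 𝟙 e * v
𝟙-guard true  u≡v = cong (_+ 0) (u≡v refl)
𝟙-guard false _   = refl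

∑-χ : {p : ℕ} (S : Subset p) → ∑[ x < p ] χ S x ≡ ∣ S ∣
∑-χ []          = refl
∑-χ (true ∷ S)  = cong suc (∑-χ S)
∑-χ (false ∷ S) = ∑-χ S

∑-const : ∀ n c → ∑[ i < n ] c ≡ n * c
∑-const zero    c = refl
∑-const (suc n) c = cong (c +_) (∑-const n c)

∑-mono-≤ : ∀ {n} {f g : Fin n → ℕ} → (∀ i → f i ≤ g i) → ∑[ i < n ] f i ≤ ∑[ i < n ] g i
∑-mono-≤ {zero}  _   = z≤n
∑-mono-≤ {suc n} f≤g = +-mono-≤ (f≤g zero) (∑-mono-≤ (f≤g ∘ suc))

term≤∑ : ∀ {n} (f : Fin n → ℕ) i → f i ≤ ∑[ j < n ] f j
term≤∑ f zero    = m≤m+n _ _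
term≤∑ f (suc i) = ≤-trans (term≤∑ (f ∘ suc) i) (m≤n+m _ _)

∑-split : ∀ a {b} (f : Fin (a + b) → ℕ) →
          ∑[ i < a + b ] f i ≡ ∑[ i < a ] f (i ↑ˡ b) + ∑[ j < b ] f (a ↑ʳ j)
∑-split zero    f = refl
∑-split (suc a) f = trans (cong (f zero +_) (∑-split a (f ∘ suc))) (sym (+-assoc (f zero) _ _))

∑∑-product : ∀ {a b} (f : Fin a → ℕ) (g : Fin b → ℕ) →
             ∑[ i < a ] ∑[ j < b ] (f i * g j) ≡ sum f * sum g
∑∑-product f g =
  trans (sum-cong-≗ (λ i → sym (*-distribˡ-sum (f i) g))) (sym (*-distribʳ-sum (sum g) f))

∑-comm₃ : ∀ {p q r s} (F : Fin p → Fin q → Fin r → Fin s → ℕ) →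
          ∑[ i < p ] ∑[ a < q ] ∑[ b < r ] ∑[ x < s ] F i a b x ≡
          ∑[ a < q ] ∑[ b < r ] ∑[ x < s ] ∑[ i < p ] F i a b x
∑-comm₃ {r = r} {s} F =
  trans (∑-comm (λ i a → ∑[ b < r ] ∑[ x < s ] F i a b x))
        (sum-cong-≗ λ a → trans (∑-comm (λ i b → ∑[ x < s ] F i a b x))
                                (sum-cong-≗ λ b → ∑-comm (λ i x → F i a b x)))

below-average : ∀ {N} (f : Fin N → ℕ) c → ∑[ i < N ] f i < N * c → Σ (Fin N) λ i → f i < c
below-average {suc N} f c ∑f<Nc with f zero <? c
... | yes f₀<c = zero , f₀<c
... | no  f₀≮c with below-average (f ∘ suc) c
                      (+-cancelˡ-< c _ _ (≤-<-trans (+-monoˡ-≤ _ (≮⇒≥ f₀≮c)) ∑f<Nc))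
...   | i , fᵢ<c = suc i , fᵢ<c

choose : ℕ → ℕ → ℕ
choose zero    zero    = 1
choose zero    (suc n) = 0
choose (suc m) zero    = choose m zero
choose (suc m) (suc n) = choose m n + choose m (suc n)

subsets : ∀ m n → Fin (choose m n) → Subset m
subsets zero    zero    _ = []
subsets (suc m) zero    s = outside ∷ subsets m zero s
subsets (suc m) (suc n)   =
  ((inside ∷_) ∘ subsets m n) Vector.++ ((outside ∷_) ∘ subsets m (suc n))

subsets-size : ∀ m n s → ∣ subsets m n s ∣ ≡ n
subsets-size zero    zero    s = refl
subsets-size (suc m) zero    s = subsets-size m zero s
subsets-size (suc m) (suc n) s with splitAt (choose m n) s
... | inj₁ i = cong suc (subsets-size m n i)
... | inj₂ j = subsets-size m (suc n) j

∑ₛ : ∀ m n → (Subset m → ℕ) → ℕ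
∑ₛ m n f = ∑[ s < choose m n ] f (subsets m n s)

∑ₛ-suc : ∀ m n (f : Subset (suc m) → ℕ) →
         ∑ₛ (suc m) (suc n) f ≡ ∑ₛ m n (f ∘ (inside ∷_)) + ∑ₛ m (suc n) (f ∘ (outside ∷_))
∑ₛ-suc m n f = trans (∑-split (choose m n) _)
  (cong₂ _+_ (sum-cong-≗ λ i → cong f (Vector.lookup-++ˡ with-0 without-0 i))
             (sum-cong-≗ λ j → cong f (Vector.lookup-++ʳ with-0 without-0 j)))
  where
  with-0    = (inside ∷_) ∘ subsets m n
  without-0 = (outside ∷_) ∘ subsets m (suc n)

size-zero-empty : ∀ m s i → χ (subsets m zero s) i ≡ 0
size-zero-empty (suc m) s zero    = refl
size-zero-empty (suc m) s (suc i) = size-zero-empty m s i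

-- containing₁ m n = C(m-1, n-1) is the number of n-subsets of Fin m
-- containing a fixed element, containing₂ m n = C(m-2, n-2) the number
-- containing two fixed distinct elements.
containing₁ : ℕ → ℕ → ℕ
containing₁ (suc m) (suc n) = choose m n
containing₁ _       _       = 0

containing₂ : ℕ → ℕ → ℕ
containing₂ (suc m) (suc n) = containing₁ m n
containing₂ _       _       = 0

containing₁-pascal : ∀ m n → containing₁ (suc m) n + containing₁ (suc m) (suc n) ≡ choose (suc m) n
containing₁-pascal m zero    = refl
containing₁-pascal m (suc n) = refl

containing₂-pascal : ∀ m n →
  containing₂ (suc (suc m)) n + containing₂ (suc (suc m)) (suc n) ≡ containing₁ (suc (suc m)) n
containing₂-pascal m zero    = refl
containing₂-pascal m (suc n) = containing₁-pascal m n

count₁ : ∀ m n (i : Fin m) → ∑ₛ m n (λ S → χ S i) ≡ containing₁ m n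
count₁ (suc m) zero i =
  trans (sum-cong-≗ λ s → size-zero-empty (suc m) s i) (sum-replicate-zero (choose m zero))
count₁ (suc m) (suc n) zero = begin
  ∑ₛ (suc m) (suc n) (λ S → χ S zero)             ≡⟨ ∑ₛ-suc m n (λ S → χ S zero) ⟩
  ∑[ s < choose m n ] 1 + ∑[ s < choose m (suc n) ] 0
    ≡⟨ cong₂ _+_ (∑-const (choose m n) 1) (sum-replicate-zero (choose m (suc n))) ⟩
  choose m n * 1 + 0                               ≡⟨ +-identityʳ _ ⟩
  choose m n * 1                                   ≡⟨ *-identityʳ _ ⟩
  choose m n                                       ∎
  where open ≡-Reasoning
count₁ (suc (suc m)) (suc n) (suc i) =
  trans (∑ₛ-suc (suc m) n (λ S → χ S (suc i)))
        (trans (cong₂ _+_ (count₁ (suc m) n i) (count₁ (suc m) (suc n) i)) (containing₁-pascal m n))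

count₂ : ∀ m n (i j : Fin m) → i ≢ j → ∑ₛ m n (λ S → χ S i * χ S j) ≡ containing₂ m n
count₂ m n zero zero i≢j = ⊥-elim (i≢j refl)
count₂ (suc m) zero i j _ =
  trans (sum-cong-≗ λ s → cong (_* χ (subsets (suc m) zero s) j) (size-zero-empty (suc m) s i))
        (sum-replicate-zero (choose m zero))
count₂ (suc m) (suc n) zero (suc j) _ =
  trans (∑ₛ-suc m n (λ S → χ S zero * χ S (suc j)))
        (trans (cong₂ _+_ (trans (sum-cong-≗ λ s → *-identityˡ (χ (subsets m n s) j)) (count₁ m n j))
                          (sum-replicate-zero (choose m (suc n))))
               (+-identityʳ _))
count₂ (suc m) (suc n) (suc i) zero _ =
  trans (∑ₛ-suc m n (λ S → χ S (suc i) * χ S zero))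
        (trans (cong₂ _+_ (trans (sum-cong-≗ λ s → *-identityʳ (χ (subsets m n s) i)) (count₁ m n i))
                          (trans (sum-cong-≗ λ s → *-zeroʳ (χ (subsets m (suc n) s) i))
                                 (sum-replicate-zero (choose m (suc n)))))
               (+-identityʳ _))
count₂ (suc (suc zero)) (suc n) (suc zero) (suc zero) i≢j = ⊥-elim (i≢j refl)
count₂ (suc (suc (suc m))) (suc n) (suc i) (suc j) i≢j =
  trans (∑ₛ-suc (suc (suc m)) n (λ S → χ S (suc i) * χ S (suc j)))
        (trans (cong₂ _+_ (count₂ (suc (suc m)) n i j (i≢j ∘ cong suc))
                          (count₂ (suc (suc m)) (suc n) i j (i≢j ∘ cong suc)))
               (containing₂-pascal m n))

absorption : ∀ m n → n * choose m n ≡ m * containing₁ m n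
absorption zero    zero    = refl
absorption zero    (suc n) = *-zeroʳ (suc n)
absorption (suc m) zero    = sym (*-zeroʳ (suc m))
absorption (suc m) (suc n) = begin
  suc n * (choose m n + choose m (suc n))
    ≡⟨ *-distribˡ-+ (suc n) (choose m n) _ ⟩
  (choose m n + n * choose m n) + suc n * choose m (suc n)
    ≡⟨ cong₂ (λ u v → choose m n + u + v) (absorption m n) (absorption m (suc n)) ⟩
  (choose m n + m * containing₁ m n) + m * containing₁ m (suc n)
    ≡⟨ +-assoc (choose m n) _ _ ⟩
  choose m n + (m * containing₁ m n + m * containing₁ m (suc n))
    ≡⟨ cong (choose m n +_) (trans (sym (*-distribˡ-+ m _ _)) (scaled-pascal m)) ⟩
  choose m n + m * choose m n
    ∎
  where
  open ≡-Reasoning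
  scaled-pascal : ∀ m → m * (containing₁ m n + containing₁ m (suc n)) ≡ m * choose m n
  scaled-pascal zero    = refl
  scaled-pascal (suc m) = cong (suc m *_) (containing₁-pascal m n)

choose-pos : ∀ {m n} → n ≤ m → 0 < choose m n
choose-pos {zero}  {zero}  _         = s≤s z≤n
choose-pos {suc m} {zero}  _         = choose-pos {m} z≤n
choose-pos {suc m} {suc n} (s≤s n≤m) = <-≤-trans (choose-pos n≤m) (m≤m+n _ _)

below-by-ratio : ∀ c n₁ m₁ Y Z → m₁ * Z ≡ n₁ * Y → c * n₁ < m₁ → 0 < Y → c * Z < Y
below-by-ratio c n₁ m₁ Y Z m₁Z≡n₁Y cn₁<m₁ 0<Y = *-cancelˡ-< m₁ (c * Z) Y (begin-strict
  m₁ * (c * Z)   ≡⟨ x∙yz≈y∙xz m₁ c Z ⟩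
  c * (m₁ * Z)   ≡⟨ cong (c *_) m₁Z≡n₁Y ⟩
  c * (n₁ * Y)   ≡⟨ *-assoc c n₁ Y ⟨
  c * n₁ * Y     <⟨ *-monoˡ-< Y {{>-nonZero 0<Y}} cn₁<m₁ ⟩
  m₁ * Y         ∎)
  where open ≤-Reasoning

-- If n X = m Y and k n² Z < Y, then m² k Y Z < X².  (Multiply both sides
-- by n²: then n² X² = (m Y)² and m² Y · k n² Z < m² Y · Y.)
square-bound : ∀ k n m X Y Z → n * X ≡ m * Y → k * (n * n) * Z < Y → 0 < m →
               m * (m * (k * (Y * Z))) < X * X
square-bound k n m X Y Z nX≡mY kn²Z<Y 0<m = *-cancelˡ-< (n * n) _ _ (begin-strict
  n * n * (m * (m * (k * (Y * Z))))  ≡⟨ regroup k n m Y Z ⟩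
  m * m * Y * (k * (n * n) * Z)      <⟨ *-monoʳ-< (m * m * Y) {{m²Y≢0}} kn²Z<Y ⟩
  m * m * Y * Y                      ≡⟨ square m Y ⟩
  (m * Y) * (m * Y)                  ≡⟨ cong (λ t → t * t) nX≡mY ⟨
  (n * X) * (n * X)                  ≡⟨ square n X ⟨
  n * n * X * X                      ≡⟨ *-assoc (n * n) X X ⟩
  n * n * (X * X)                    ∎)
  where
  open ≤-Reasoning
  regroup : ∀ k n m Y Z → n * n * (m * (m * (k * (Y * Z)))) ≡ m * m * Y * (k * (n * n) * Z)
  regroup = solve-∀
  square : ∀ a b → a * a * b * b ≡ (a * b) * (a * b)
  square = solve-∀
  0<Y : 0 < Y
  0<Y = ≤-<-trans z≤n kn²Z<Y
  m²Y≢0 : NonZero (m * m * Y)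
  m²Y≢0 = >-nonZero (*-mono-< (*-mono-< 0<m 0<m) 0<Y)

containing₂-one : ∀ m → containing₂ m 1 ≡ 0
containing₂-one zero          = refl
containing₂-one (suc zero)    = refl
containing₂-one (suc (suc m)) = refl

-- n ≤ k n³; together with k n³ ≤ m it gives n ≤ m and, for n ≥ 1, m > 0.
n≤kn³ : ∀ k n → 0 < k → n ≤ k * n ^ 3
n≤kn³ k       zero    _   = z≤n
n≤kn³ (suc k) (suc n) _   = ≤-trans (m≤m*n (suc n) (suc n * (suc n * 1))) (m≤n*m (suc n ^ 3) (suc k))

-- For m ≥ k n³ a random n-subset containing a fixed element contains a
-- second fixed element with probability C(m-2,n-2)/C(m-1,n-1) < 1/(k n²).
pairs-rare : ∀ k n m → 0 < k → 1 ≤ n → k * n ^ 3 ≤ m →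
             k * (n * n) * containing₂ m n < containing₁ m n
pairs-rare k n m 0<k 1≤n kn³≤m = by-size n m 1≤n (≤-trans (n≤kn³ k n 0<k) kn³≤m) kn³≤m
  where
  -- For n = 1 the left side is 0; for n ≥ 2 use absorption and below-by-ratio.
  by-size : ∀ n m → 1 ≤ n → n ≤ m → k * n ^ 3 ≤ m → k * (n * n) * containing₂ m n < containing₁ m n
  by-size (suc zero) (suc m₁) _ _ _ =
    subst (_< choose m₁ zero)
          (sym (trans (cong (k * 1 *_) (containing₂-one (suc m₁))) (*-zeroʳ (k * 1))))
          (choose-pos {m₁} z≤n)
  by-size n@(suc n₁@(suc _)) (suc m₁) _ (s≤s n₁≤m₁) kn³≤m =
    below-by-ratio (k * (n * n)) n₁ m₁ (choose m₁ n₁) (containing₁ m₁ n₁)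
                   (sym (absorption m₁ n₁)) ratio (choose-pos n₁≤m₁)
    where
    cube : ∀ k n₁ → k * ((1 + n₁) * ((1 + n₁) * ((1 + n₁) * 1))) ≡
                    k * ((1 + n₁) * (1 + n₁)) * n₁ + k * ((1 + n₁) * (1 + n₁))
    cube = solve-∀
    2≤kn² : 2 ≤ k * (n * n)
    2≤kn² = ≤-trans (s≤s (s≤s z≤n))
              (≤-trans (m≤m*n n n) (m≤n*m (n * n) k {{>-nonZero 0<k}}))
    ratio : k * (n * n) * n₁ < m₁
    ratio = s≤s⁻¹ (begin
      2 + k * (n * n) * n₁               ≡⟨ +-comm 2 _ ⟩
      k * (n * n) * n₁ + 2               ≤⟨ +-monoʳ-≤ _ 2≤kn² ⟩
      k * (n * n) * n₁ + k * (n * n)     ≡⟨ cube k n₁ ⟨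
      k * n ^ 3                          ≤⟨ kn³≤m ⟩
      suc m₁                             ∎)
      where open ≤-Reasoning

-- The expected number of violations is below 1 (see square-bound).
few-violations : ∀ k n m → 0 < k → 1 ≤ n → k * n ^ 3 ≤ m →
  m * (m * (k * (containing₁ m n * containing₂ m n))) < choose m n * choose m n
few-violations k n m 0<k 1≤n kn³≤m =
  square-bound k n m (choose m n) (containing₁ m n) (containing₂ m n)
               (absorption m n) (pairs-rare k n m 0<k 1≤n kn³≤m)
               (≤-trans 1≤n (≤-trans (n≤kn³ k n 0<k) kn³≤m))

module Violations {m : ℕ} (M : SqInterferenceMatrix m) where

  E : Fin m → Fin m → Subset (m + m)
  E = entry M

  -- incidence A B a b x = 1 iff a ∈ A, b ∈ B and x ∈ A ∪ B, where A ∪ B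
  -- is the subset A ++ B of the index set Fin (m + m) of rows and columns.
  incidence : Subset m → Subset m → Fin m → Fin m → Fin (m + m) → ℕ
  incidence A B a b x = χ A a * χ B b * χ (A Vec.++ B) x

  violations : Subset m → Subset m → ℕ
  violations A B = ∑[ a < m ] ∑[ b < m ] ∑[ x < m + m ] (χ (E a b) x * incidence A B a b x)

  χ-row : ∀ (A B : Subset m) a' → χ (A Vec.++ B) (row a') ≡ χ A a'
  χ-row A B a' = cong 𝟙 (lookup-++ˡ A B a')

  χ-col : ∀ (A B : Subset m) b' → χ (A Vec.++ B) (col b') ≡ χ B b'
  χ-col A B b' = cong 𝟙 (lookup-++ʳ A B b')

  no-violation⇒proper : ∀ A B → violations A B < 1 → ProperSub M A B
  no-violation⇒proper A B none a b a∈A b∈B =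
      (λ a' a'∈A row∈E → ≤⇒≯ (violation (row a') row∈E (trans (χ-row A B a') (∈⇒χ≡1 a'∈A))) none)
    , (λ b' b'∈B col∈E → ≤⇒≯ (violation (col b') col∈E (trans (χ-col A B b') (∈⇒χ≡1 b'∈B))) none)
    where
    violation : ∀ x → x ∈ E a b → χ (A Vec.++ B) x ≡ 1 → 1 ≤ violations A B
    violation x x∈E x∈A∪B = ≤-trans (≤-reflexive (sym contribution))
      (≤-trans (term≤∑ _ x) (≤-trans (term≤∑ _ b) (term≤∑ _ a)))
      where
      contribution : χ (E a b) x * incidence A B a b x ≡ 1
      contribution = cong₂ _*_ (∈⇒χ≡1 x∈E)
                       (cong₂ _*_ (cong₂ _*_ (∈⇒χ≡1 a∈A) (∈⇒χ≡1 b∈B)) x∈A∪B)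

  row-outside : ∀ a b a' → lookup (E a b) (row a') ≡ true → a ≢ a'
  row-outside a b a' row∈E refl = noRow M a b (lookup⇒[]= (row a) (E a b) row∈E)

  col-outside : ∀ a b b' → lookup (E a b) (col b') ≡ true → b ≢ b'
  col-outside a b b' col∈E refl = noCol M a b (lookup⇒[]= (col b) (E a b) col∈E)

  module Counting (n : ℕ) where

    N : ℕ
    N = choose m n

    S : Fin N → Subset m
    S = subsets m n

    ∑∑ : (Subset m → Subset m → ℕ) → ℕ
    ∑∑ F = ∑ₛ m n λ A → ∑ₛ m n λ B → F A B

    ∑∑-*ˡ : ∀ c F → ∑∑ (λ A B → c * F A B) ≡ c * ∑∑ F
    ∑∑-*ˡ c F = trans (sum-cong-≗ λ s → sym (*-distribˡ-sum c (λ t → F (S s) (S t))))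
                      (sym (*-distribˡ-sum c (λ s → ∑ₛ m n (F (S s)))))

    ∑∑-inside : ∀ (G : Subset m → Subset m → Fin m → Fin m → Fin (m + m) → ℕ) →
      ∑∑ (λ A B → ∑[ a < m ] ∑[ b < m ] ∑[ x < m + m ] G A B a b x) ≡
      ∑[ a < m ] ∑[ b < m ] ∑[ x < m + m ] ∑∑ (λ A B → G A B a b x)
    ∑∑-inside G =
      trans (sum-cong-≗ λ s → ∑-comm₃ (λ t → G (S s) (S t)))
            (∑-comm₃ (λ s a b x → ∑ₛ m n λ B → G (S s) B a b x))

    -- The number of pairs (A, B) counting a given potential violation.
    pair-weight : ℕ
    pair-weight = containing₁ m n * containing₂ m n

    row-incidences : ∀ a b a' → a ≢ a' → ∑∑ (λ A B → incidence A B a b (row a')) ≡ pair-weight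
    row-incidences a b a' a≢a' = begin
      ∑∑ (λ A B → incidence A B a b (row a'))
        ≡⟨ sum-cong-≗ (λ s → sum-cong-≗ λ t → trans (cong (χ (S s) a * χ (S t) b *_) (χ-row (S s) (S t) a'))
                                                    (xy∙z≈xz∙y (χ (S s) a) (χ (S t) b) (χ (S s) a'))) ⟩
      ∑∑ (λ A B → (χ A a * χ A a') * χ B b)
        ≡⟨ ∑∑-product (λ s → χ (S s) a * χ (S s) a') (λ t → χ (S t) b) ⟩
      ∑ₛ m n (λ A → χ A a * χ A a') * ∑ₛ m n (λ B → χ B b)
        ≡⟨ cong₂ _*_ (count₂ m n a a' a≢a') (count₁ m n b) ⟩
      containing₂ m n * containing₁ m n
        ≡⟨ *-comm (containing₂ m n) _ ⟩
      pair-weight ∎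
      where open ≡-Reasoning

    col-incidences : ∀ a b b' → b ≢ b' → ∑∑ (λ A B → incidence A B a b (col b')) ≡ pair-weight
    col-incidences a b b' b≢b' = begin
      ∑∑ (λ A B → incidence A B a b (col b'))
        ≡⟨ sum-cong-≗ (λ s → sum-cong-≗ λ t → trans (cong (χ (S s) a * χ (S t) b *_) (χ-col (S s) (S t) b'))
                                                    (*-assoc (χ (S s) a) (χ (S t) b) (χ (S t) b'))) ⟩
      ∑∑ (λ A B → χ A a * (χ B b * χ B b'))
        ≡⟨ ∑∑-product (λ s → χ (S s) a) (λ t → χ (S t) b * χ (S t) b') ⟩
      ∑ₛ m n (λ A → χ A a) * ∑ₛ m n (λ B → χ B b * χ B b')
        ≡⟨ cong₂ _*_ (count₁ m n a) (count₂ m n b b' b≢b') ⟩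
      pair-weight ∎
      where open ≡-Reasoning

    entry-incidences : ∀ a b →
      ∑[ x < m + m ] (χ (E a b) x * ∑∑ (λ A B → incidence A B a b x)) ≡ ∣ E a b ∣ * pair-weight
    entry-incidences a b = begin
      ∑[ x < m + m ] (χ (E a b) x * ∑∑ (λ A B → incidence A B a b x))
        ≡⟨ ∑-split m _ ⟩
      ∑[ a' < m ] (χ (E a b) (row a') * ∑∑ (λ A B → incidence A B a b (row a'))) +
      ∑[ b' < m ] (χ (E a b) (col b') * ∑∑ (λ A B → incidence A B a b (col b')))
        ≡⟨ cong₂ _+_ (sum-cong-≗ λ a' → 𝟙-guard _ (row-incidences a b a' ∘ row-outside a b a'))
                     (sum-cong-≗ λ b' → 𝟙-guard _ (col-incidences a b b' ∘ col-outside a b b')) ⟩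
      ∑[ a' < m ] (χ (E a b) (row a') * pair-weight) + ∑[ b' < m ] (χ (E a b) (col b') * pair-weight)
        ≡⟨ ∑-split m (λ x → χ (E a b) x * pair-weight) ⟨
      ∑[ x < m + m ] (χ (E a b) x * pair-weight)
        ≡⟨ *-distribʳ-sum pair-weight (χ (E a b)) ⟨
      (∑[ x < m + m ] χ (E a b) x) * pair-weight
        ≡⟨ cong (_* pair-weight) (∑-χ (E a b)) ⟩
      ∣ E a b ∣ * pair-weight ∎
      where open ≡-Reasoning

    total-violations : ∀ {k} → IsKInterference k M → ∑∑ violations ≤ m * (m * (k * pair-weight))
    total-violations {k} isK = begin
      ∑∑ violations
        ≡⟨ ∑∑-inside (λ A B a b x → χ (E a b) x * incidence A B a b x) ⟩
      ∑[ a < m ] ∑[ b < m ] ∑[ x < m + m ] ∑∑ (λ A B → χ (E a b) x * incidence A B a b x)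
        ≡⟨ sum-cong-≗ (λ a → sum-cong-≗ λ b → sum-cong-≗ λ x →
             ∑∑-*ˡ (χ (E a b) x) (λ A B → incidence A B a b x)) ⟩
      ∑[ a < m ] ∑[ b < m ] ∑[ x < m + m ] (χ (E a b) x * ∑∑ (λ A B → incidence A B a b x))
        ≡⟨ sum-cong-≗ (λ a → sum-cong-≗ λ b → entry-incidences a b) ⟩
      ∑[ a < m ] ∑[ b < m ] (∣ E a b ∣ * pair-weight)
        ≤⟨ ∑-mono-≤ (λ a → ∑-mono-≤ λ b → *-monoˡ-≤ pair-weight (isK a b)) ⟩
      ∑[ a < m ] ∑[ b < m ] (k * pair-weight)
        ≡⟨ sum-cong-≗ {m} (λ a → ∑-const m (k * pair-weight)) ⟩
      ∑[ a < m ] (m * (k * pair-weight))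
        ≡⟨ ∑-const m (m * (k * pair-weight)) ⟩
      m * (m * (k * pair-weight)) ∎
      where open ≤-Reasoning

    -- Since the total is below C(m,n)², averaging twice yields a pair
    -- (A, B) of n-subsets without any violation.
    proper-exists : ∀ k → 0 < k → 1 ≤ n → k * n ^ 3 ≤ m → IsKInterference k M →
                    HasProperSquareSub M n
    proper-exists k 0<k 1≤n kn³≤m isK
      with below-average (λ s → ∑[ t < N ] violations (S s) (S t)) N
             (≤-<-trans (total-violations isK) (few-violations k n m 0<k 1≤n kn³≤m))
    ... | s , row-total<N
      with below-average (λ t → violations (S s) (S t)) 1
             (subst (∑[ t < N ] violations (S s) (S t) <_) (sym (*-identityʳ N)) row-total<N)
    ... | t , none =
      S s , S t , subsets-size m n s , subsets-size m n t , no-violation⇒proper (S s) (S t) none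

lemma13 : (k n : ℕ) → 0 < k → n ≥ 1 →
    (m : ℕ) (M : SqInterferenceMatrix m) →
    IsKInterference k M → ¬ HasProperSquareSub M n →
    m < k * n ^ 3
lemma13 k n 0<k 1≤n m M isK no-proper with m <? k * n ^ 3
... | yes m<kn³ = m<kn³
... | no  m≮kn³ = ⊥-elim (no-proper (Violations.Counting.proper-exists M n k 0<k 1≤n (≮⇒≥ m≮kn³) isK))
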